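{- Let $\mathfrak{A}$ be a one-sorted structure with domain $A$. Then the following predicates are first-order definable (without parameters) in $\mathrm{WMS}(\mathfrak{A})$: (1) $\mathsf{CLess}(x,X,Y)$, which for $a\in A$ and finite multisets $Q_1,Q_2$ over $A$ holds iff the multiplicity of $a$ in $Q_1$ is less than the multiplicity of $a$ in $Q_2$; (2) $\mathsf{CEq}(x,X,Y)$, which holds iff the multiplicity of $a$ in $Q_1$ equals the multiplicity of $a$ in $Q_2$; (3) $\mathsf{CS}(x,X,Y)$, which holds iff the multiplicity of $a$ in $Q_1$ equals the multiplicity of $a$ in $Q_2$ minus $1$.
   Context: A finite multiset is a function $f$ with finite domain and range contained in $\{1,2,3,\dots\}$. The multiplicity of $x$ in $f$ is $f(x)$ if $x\in\mathrm{dom}(f)$ and $0$ otherwise; $x\in_Mf$ iff the multiplicity of $x$ in $f$ is $>0$; $f\subset_Mg$ iff $\mathrm{dom}(f)\subseteq\mathrm{dom}(g)$ and $f(x)\le g(x)$ for all $x\in\mathrm{dom}(f)$. For a set $A$, $\mathcal{P}^{<\omega}_{\mathrm{multi}}(A)$ is the set of finite multisets with domain contained in $A$. $\mathrm{WMS}(\mathfrak{A})$ is the two-sorted structure extending $\mathfrak{A}$ by a second sort with domain $\mathcal{P}^{<\omega}_{\mathrm{multi}}(A)$, the relation $\in_M$ between the first and second sort, and the relation $\subset_M$ on the second sort (first-order logic with equality on each sort). -}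

module Defs where

open import Data.Nat using (ℕ; zero; suc; _<_; _≤_)
open import Data.Fin using (Fin)
open import Data.Vec using (Vec; []; _∷_)
open import Data.List using (List)
open import Data.List.Membership.Propositional using (_∈_)
open import Data.Product using (Σ; _×_; _,_)
open import Data.Sum using (_⊎_)
open import Data.Empty using (⊥)
open import Data.Unit using (⊤)
open import Relation.Binary.PropositionalEquality using (_≡_)
open import Function.Bundles using (_⇔_)

-- A finite multiset f (finite domain, values in {1,2,...}) is represented
-- by its multiplicity function A → ℕ (value 0 exactly outside dom f),
-- together with a finite list covering its support (= dom f).

record MSet (A : Set) : Set where
  constructor mset
  field
    mult    : A → ℕ
    support : List A
    finite  : ∀ a → 0 < mult a → a ∈ support

open MSet public

multiplicity : {A : Set} → A → MSet A → ℕ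
multiplicity x Q = mult Q x

_∈M_ : {A : Set} → A → MSet A → Set
x ∈M Q = 0 < mult Q x

_⊂M_ : {A : Set} → MSet A → MSet A → Set
Q ⊂M R = ∀ x → mult Q x ≤ mult R x

_≡M_ : {A : Set} → MSet A → MSet A → Set
Q ≡M R = ∀ x → mult Q x ≡ mult R x

record Signature : Set₁ where
  field
    FunSym  : Set
    funAr   : FunSym → ℕ
    RelSym  : Set
    relAr   : RelSym → ℕ

open Signature public

record Structure (L : Signature) : Set₁ where
  field
    Dom    : Set
    funI   : (f : FunSym L) → Vec Dom (funAr L f) → Dom
    relI   : (r : RelSym L) → Vec Dom (relAr L r) → Set

open Structure public

-- First-order formulas of the two-sorted language of WMS(𝔄):
-- n free first-sort variables, m free second-sort variables (de Bruijn).

data Term (L : Signature) (n : ℕ) : Set where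
  var : Fin n → Term L n
  app : (f : FunSym L) → Vec (Term L n) (funAr L f) → Term L n

data Formula (L : Signature) (n m : ℕ) : Set where
  ⊥f   : Formula L n m
  rel  : (r : RelSym L) → Vec (Term L n) (relAr L r) → Formula L n m
  eq₁  : Term L n → Term L n → Formula L n m
  eq₂  : Fin m → Fin m → Formula L n m
  memM : Term L n → Fin m → Formula L n m
  subM : Fin m → Fin m → Formula L n m
  _∧f_ : Formula L n m → Formula L n m → Formula L n m
  _∨f_ : Formula L n m → Formula L n m → Formula L n m
  _⇒f_ : Formula L n m → Formula L n m → Formula L n m
  ¬f_  : Formula L n m → Formula L n m
  ∀₁   : Formula L (suc n) m → Formula L n m
  ∃₁   : Formula L (suc n) m → Formula L n m
  ∀₂   : Formula L n (suc m) → Formula L n m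
  ∃₂   : Formula L n (suc m) → Formula L n m

extend : {B : Set} {n : ℕ} → B → (Fin n → B) → Fin (suc n) → B
extend b ρ Fin.zero    = b
extend b ρ (Fin.suc i) = ρ i

module _ {L : Signature} (𝔄 : Structure L) where

  evalT  : {n : ℕ} → (Fin n → Dom 𝔄) → Term L n → Dom 𝔄
  evalTs : {n k : ℕ} → (Fin n → Dom 𝔄) → Vec (Term L n) k → Vec (Dom 𝔄) k
  evalT ρ (var i)    = ρ i
  evalT ρ (app f ts) = funI 𝔄 f (evalTs ρ ts)
  evalTs ρ []       = []
  evalTs ρ (t ∷ ts) = evalT ρ t ∷ evalTs ρ ts

  Sat : {n m : ℕ} → (Fin n → Dom 𝔄) → (Fin m → MSet (Dom 𝔄)) → Formula L n m → Set
  Sat ρ σ ⊥f          = ⊥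
  Sat ρ σ (rel r ts)  = relI 𝔄 r (evalTs ρ ts)
  Sat ρ σ (eq₁ s t)   = evalT ρ s ≡ evalT ρ t
  Sat ρ σ (eq₂ X Y)   = σ X ≡M σ Y
  Sat ρ σ (memM t X)  = evalT ρ t ∈M σ X
  Sat ρ σ (subM X Y)  = σ X ⊂M σ Y
  Sat ρ σ (φ ∧f ψ)    = Sat ρ σ φ × Sat ρ σ ψ
  Sat ρ σ (φ ∨f ψ)    = Sat ρ σ φ ⊎ Sat ρ σ ψ
  Sat ρ σ (φ ⇒f ψ)    = Sat ρ σ φ → Sat ρ σ ψ
  Sat ρ σ (¬f φ)      = Sat ρ σ φ → ⊥
  Sat ρ σ (∀₁ φ)      = (a : Dom 𝔄) → Sat (extend a ρ) σ φ
  Sat ρ σ (∃₁ φ)      = Σ (Dom 𝔄) λ a → Sat (extend a ρ) σ φ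
  Sat ρ σ (∀₂ φ)      = (Q : MSet (Dom 𝔄)) → Sat ρ (extend Q σ) φ
  Sat ρ σ (∃₂ φ)      = Σ (MSet (Dom 𝔄)) λ Q → Sat ρ (extend Q σ) φ

env₁ : {B : Set} → B → Fin 1 → B
env₁ a _ = a

env₂ : {B : Set} → B → B → Fin 2 → B
env₂ Q₁ Q₂ Fin.zero    = Q₁
env₂ Q₁ Q₂ (Fin.suc _) = Q₂

Definable : {L : Signature} (𝔄 : Structure L) →
            (Dom 𝔄 → MSet (Dom 𝔄) → MSet (Dom 𝔄) → Set) → Set
Definable {L} 𝔄 P =
  Σ (Formula L 1 2) λ φ →
    ∀ (a : Dom 𝔄) (Q₁ Q₂ : MSet (Dom 𝔄)) →
      Sat 𝔄 (env₁ a) (env₂ Q₁ Q₂) φ ⇔ P a Q₁ Q₂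

{-# OPTIONS --safe #-}
-- Multiplicities at a point a are compared through submultisets concentrated
-- on a: Q₁(a) < Q₂(a) iff some Z ⊂M Q₂ all of whose elements equal a is not
-- ⊂M Q₁ (take Z = Q₂ restricted to a). Equality is the absence of both strict
-- inequalities, and Q₁(a) + 1 = Q₂(a) iff Q₁(a) < Q₂(a) and no multiset W has
-- Q₁(a) < W(a) < Q₂(a) (all intermediate values are attained by capping Q₂).
module Submission where

open import Defs
open import Data.Nat using (ℕ; suc; _<_; _≤_; _<?_; _⊓_; z≤n)
open import Data.Nat.Properties
  using (≤-refl; ≤-reflexive; ≤-trans; ≤-<-trans; ≤-antisym; ≤-irrelevant; <-irrefl; <⇒≤;
         <⇒≱; ≮⇒≥; ≰⇒>; m≤n⇒m<n∨m≡n; m⊓n≤m; m≥n⇒m⊓n≡n)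
open import Data.Fin using (Fin; _≟_) renaming (zero to fz; suc to fs)
open import Data.List using (length; lookup)
open import Data.List.Relation.Unary.Any using (index)
open import Data.List.Relation.Unary.Any.Properties using (lookup-index)
open import Data.Product using (Σ; ∃; _×_; _,_)
open import Data.Product.Function.NonDependent.Propositional using (_×-⇔_)
open import Data.Product.Function.Dependent.Propositional using (congˡ)
open import Data.Sum using (_⊎_; inj₁; inj₂)
open import Function.Bundles using (_⇔_; mk⇔)
open import Function.Construct.Composition using (_⇔-∘_)
open import Function.Construct.Symmetry using (⇔-sym)
open import Function.Related.TypeIsomorphisms using (¬-cong-⇔)
open import Relation.Nullary using (yes; no; ¬_; contradiction)
open import Relation.Binary.PropositionalEquality

suc≡⇔<×nothing-between : ∀ {m n} → suc m ≡ n ⇔ (m < n × ¬ ∃ λ k → m < k × k < n)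
suc≡⇔<×nothing-between {m} = mk⇔ to from
  where
  to : ∀ {n} → suc m ≡ n → m < n × ¬ ∃ λ k → m < k × k < n
  to refl = ≤-refl , λ (k , m<k , k<1+m) → <⇒≱ k<1+m m<k
  from : ∀ {n} → m < n × ¬ ∃ (λ k → m < k × k < n) → suc m ≡ n
  from (m<n , nothing-between) with m≤n⇒m<n∨m≡n m<n
  ... | inj₁ 1+m<n = contradiction (suc m , ≤-refl , 1+m<n) nothing-between
  ... | inj₂ 1+m≡n = 1+m≡n

≮×≯⇔≡ : ∀ {m n} → (¬ m < n × ¬ n < m) ⇔ m ≡ n
≮×≯⇔≡ = mk⇔ (λ (m≮n , n≮m) → ≤-antisym (≮⇒≥ n≮m) (≮⇒≥ m≮n))
            (λ { refl → <-irrefl refl , <-irrefl refl })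

module _ {A : Set} where

  ConcentratedOn : A → MSet A → Set
  ConcentratedOn a Z = ∀ x → x ∈M Z → x ≡ a

  concentrated-⊂M : ∀ {a} {Z Q : MSet A} →
    ConcentratedOn a Z → mult Z a ≤ mult Q a → Z ⊂M Q
  concentrated-⊂M {Z = Z} only-a Za≤Qa x with 0 <? mult Z x
  ... | no x∉Z = ≤-trans (≮⇒≥ x∉Z) z≤n
  ... | yes x∈Z with only-a x x∈Z
  ...   | refl = Za≤Qa

  cap : MSet A → ℕ → MSet A
  cap Q k = mset (λ x → mult Q x ⊓ k) (support Q)
                 (λ x p → finite Q x (≤-trans p (m⊓n≤m (mult Q x) k)))

  cap-at : ∀ {Q : MSet A} {x k} → k ≤ mult Q x → mult (cap Q k) x ≡ k
  cap-at = m≥n⇒m⊓n≡n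

  module Restriction (Q : MSet A) {a : A} (a∈Q : a ∈M Q) where

    -- A has no decidable equality, so we compare positions in the support
    -- list instead: equal positions force equal elements.
    position : ∀ {x} → x ∈M Q → Fin (length (support Q))
    position {x} x∈Q = index (finite Q x x∈Q)

    samePosition⇒≡ : ∀ {x y} {x∈Q : x ∈M Q} {y∈Q : y ∈M Q} →
      position x∈Q ≡ position y∈Q → x ≡ y
    samePosition⇒≡ {x} {y} {x∈Q} {y∈Q} same = begin
      x                                  ≡⟨ lookup-index (finite Q x x∈Q) ⟩
      lookup (support Q) (position x∈Q)  ≡⟨ cong (lookup (support Q)) same ⟩
      lookup (support Q) (position y∈Q)  ≡⟨ lookup-index (finite Q y y∈Q) ⟨
      y                                  ∎
      where open ≡-Reasoning

    restrictedMult : A → ℕ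
    restrictedMult x with 0 <? mult Q x
    ... | no _ = 0
    ... | yes x∈Q with position x∈Q ≟ position a∈Q
    ...   | yes _ = mult Q x
    ...   | no _ = 0

    restrictedMult-cases : ∀ x →
      (x ≡ a × restrictedMult x ≡ mult Q x) ⊎ restrictedMult x ≡ 0
    restrictedMult-cases x with 0 <? mult Q x
    ... | no _ = inj₂ refl
    ... | yes x∈Q with position x∈Q ≟ position a∈Q
    ...   | yes same = inj₁ (samePosition⇒≡ same , refl)
    ...   | no _ = inj₂ refl

    restrictedMult≤mult : ∀ x → restrictedMult x ≤ mult Q x
    restrictedMult≤mult x with restrictedMult-cases x
    ... | inj₁ (_ , eq) = ≤-reflexive eq
    ... | inj₂ eq rewrite eq = z≤n

    restricted : MSet A
    restricted = mset restrictedMult (support Q)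
      (λ x p → finite Q x (≤-trans p (restrictedMult≤mult x)))

    restricted-concentrated : ConcentratedOn a restricted
    restricted-concentrated x x∈R with restrictedMult-cases x
    ... | inj₁ (x≡a , _) = x≡a
    ... | inj₂ eq = contradiction (subst (0 <_) eq x∈R) (<-irrefl refl)

    restricted-at : mult restricted a ≡ mult Q a
    restricted-at with 0 <? mult Q a
    ... | no a∉Q = contradiction a∈Q a∉Q
    ... | yes a∈Q′ with position a∈Q′ ≟ position a∈Q
    ...   | yes _ = refl
    ...   | no different = contradiction (cong position (≤-irrelevant a∈Q′ a∈Q)) different

  <⇔concentrated-witness : ∀ {a} {X Y : MSet A} → mult X a < mult Y a ⇔
    Σ (MSet A) λ Z → ConcentratedOn a Z × Z ⊂M Y × ¬ Z ⊂M X
  <⇔concentrated-witness {a} {X} {Y} = mk⇔ to from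
    where
    to : mult X a < mult Y a → Σ (MSet A) λ Z → ConcentratedOn a Z × Z ⊂M Y × ¬ Z ⊂M X
    to Xa<Ya = restricted , restricted-concentrated , restrictedMult≤mult ,
               λ R⊂X → <⇒≱ Xa<Ya (subst (_≤ mult X a) restricted-at (R⊂X a))
      where open Restriction Y (≤-<-trans z≤n Xa<Ya)
    from : (Σ (MSet A) λ Z → ConcentratedOn a Z × Z ⊂M Y × ¬ Z ⊂M X) → mult X a < mult Y a
    from (Z , only-a , Z⊂Y , Z⊄X) =
      ≰⇒> λ Ya≤Xa → Z⊄X (concentrated-⊂M {Z = Z} {X} only-a (≤-trans (Z⊂Y a) Ya≤Xa))

  intermediate-multiplicities : ∀ {a} {Y : MSet A} {m} →
    (Σ (MSet A) λ W → m < mult W a × mult W a < mult Y a) ⇔ (∃ λ k → m < k × k < mult Y a)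
  intermediate-multiplicities {a} {Y} {m} = mk⇔
    (λ (W , m<Wa , Wa<Ya) → mult W a , m<Wa , Wa<Ya)
    (λ (k , m<k , k<Ya) → let Wa≡k = cap-at {Y} (<⇒≤ k<Ya) in
      cap Y k , subst (m <_) (sym Wa≡k) m<k , subst (_< mult Y a) (sym Wa≡k) k<Ya)

module _ {L : Signature} where

  CLess : ∀ {n m} → Fin n → Fin m → Fin m → Formula L n m
  CLess k i j = ∃₂ (∀₁ (memM (var fz) fz ⇒f eq₁ (var fz) (var (fs k)))
                    ∧f (subM fz (fs j) ∧f (¬f subM fz (fs i))))

  CEq : ∀ {n m} → Fin n → Fin m → Fin m → Formula L n m
  CEq k i j = (¬f CLess k i j) ∧f (¬f CLess k j i)

  CS : ∀ {n m} → Fin n → Fin m → Fin m → Formula L n m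
  CS k i j = CLess k i j ∧f (¬f ∃₂ (CLess k (fs i) fz ∧f CLess k fz (fs j)))

module Semantics {L : Signature} (𝔄 : Structure L) where

  Sat-CLess : ∀ {n m} (ρ : Fin n → Dom 𝔄) (σ : Fin m → MSet (Dom 𝔄)) k i j →
    Sat 𝔄 ρ σ (CLess k i j) ⇔ mult (σ i) (ρ k) < mult (σ j) (ρ k)
  Sat-CLess ρ σ k i j = ⇔-sym (<⇔concentrated-witness {X = σ i} {σ j})

  Sat-CEq : ∀ {n m} (ρ : Fin n → Dom 𝔄) (σ : Fin m → MSet (Dom 𝔄)) k i j →
    Sat 𝔄 ρ σ (CEq k i j) ⇔ mult (σ i) (ρ k) ≡ mult (σ j) (ρ k)
  Sat-CEq ρ σ k i j =
    ≮×≯⇔≡ ⇔-∘ (¬-cong-⇔ (Sat-CLess ρ σ k i j) ×-⇔ ¬-cong-⇔ (Sat-CLess ρ σ k j i))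

  Sat-CS : ∀ {n m} (ρ : Fin n → Dom 𝔄) (σ : Fin m → MSet (Dom 𝔄)) k i j →
    Sat 𝔄 ρ σ (CS k i j) ⇔ suc (mult (σ i) (ρ k)) ≡ mult (σ j) (ρ k)
  Sat-CS ρ σ k i j =
    ⇔-sym suc≡⇔<×nothing-between ⇔-∘
      (Sat-CLess ρ σ k i j ×-⇔ ¬-cong-⇔ (intermediate-multiplicities {Y = σ j} ⇔-∘ congˡ
        λ {W} → Sat-CLess ρ (extend W σ) k (fs i) fz ×-⇔ Sat-CLess ρ (extend W σ) k fz (fs j)))

lemma11 : (L : Signature) (𝔄 : Structure L) →
    Definable 𝔄 (λ a Q₁ Q₂ → multiplicity a Q₁ < multiplicity a Q₂)
    × Definable 𝔄 (λ a Q₁ Q₂ → multiplicity a Q₁ ≡ multiplicity a Q₂)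
    × Definable 𝔄 (λ a Q₁ Q₂ → suc (multiplicity a Q₁) ≡ multiplicity a Q₂)
lemma11 L 𝔄 =
    (CLess x X Y , λ a Q₁ Q₂ → Sat-CLess (env₁ a) (env₂ Q₁ Q₂) x X Y)
  , (CEq x X Y , λ a Q₁ Q₂ → Sat-CEq (env₁ a) (env₂ Q₁ Q₂) x X Y)
  , (CS x X Y , λ a Q₁ Q₂ → Sat-CS (env₁ a) (env₂ Q₁ Q₂) x X Y)
  where
  open Semantics 𝔄
  x : Fin 1
  x = fz
  X Y : Fin 2
  X = fz
  Y = fs fz
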